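{- Let $\varphi=\vec{\mathbb{E}}\,\exists^T\pi_1\cdots\exists^T\pi_n\,\forall^T\pi'_1\cdots\forall^T\pi'_m\,\vec{\mathbb{Q}}\,\varphi_{qf}$ be a hypertrace formula in prenex normal form, where $\vec{\mathbb{E}}$ is any sequence of existential time quantifiers and existential unconstrained trace quantifiers, $\vec{\mathbb{Q}}$ is any sequence of time quantifiers and unconstrained trace quantifiers, and $\varphi_{qf}$ is quantifier-free. Then there exists an unconstrained hypertrace formula $\varphi_u$ such that $\mathcal{L}(\varphi)\neq\emptyset$ iff $\mathcal{L}(\varphi_u)\neq\emptyset$.
   Context: Fix a finite set $\mathcal{X}$ of propositional variables; a trace is an infinite sequence of subsets of $\mathcal{X}$, $(2^{\mathcal{X}})^\omega$ the set of all traces. Hypertrace formulas over trace variables and disjoint time variables: $\varphi ::= \exists\pi\,\varphi \mid \exists^{T}\pi\,\varphi \mid \exists i\,\varphi \mid \neg\varphi \mid \varphi\vee\varphi \mid i<j \mid i=j \mid x(\pi,i)$, $x\in\mathcal{X}$; $\exists\pi$ is an unconstrained trace quantifier, $\exists^T\pi$ a constrained trace quantifier, $\exists i$ a time quantifier; $\forall$, $\forall^T$ the dual abbreviations. Semantics over $T\subseteq(2^{\mathcal{X}})^\omega$ with a trace assignment and a time assignment: $\exists\pi$ ranges over all of $(2^{\mathcal{X}})^\omega$, $\exists^T\pi$ over $T$, $\exists i$ over $\mathbb{N}$; $<,=$ as in $\mathbb{N}$; $x(\pi,i)$ holds iff $x$ belongs to the valuation at position (value of $i$) of the trace assigned to $\pi$.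 $T\models\varphi$ iff some pair of assignments satisfies $\varphi$ over $T$; $\mathcal{L}(\varphi)=\{T\subseteq(2^{\mathcal{X}})^\omega\mid T\models\varphi\}$. A hypertrace formula is unconstrained if it contains no constrained trace quantifiers. -}

module Defs where

open import Level using (0ℓ)
open import Data.Nat using (ℕ; _≡ᵇ_) renaming (_<_ to _<ℕ_)
open import Data.Bool using (if_then_else_)
open import Data.Fin using (Fin)
open import Data.Fin.Subset using (Subset; _∈_)
open import Data.List using (List; []; _∷_; _++_; map)
open import Data.List.Relation.Unary.All using (All)
open import Data.Product using (Σ; _×_)
open import Data.Sum using (_⊎_)
open import Data.Empty using (⊥)
open import Relation.Unary using (Pred)
open import Relation.Binary.PropositionalEquality using (_≡_)
open import Relation.Nullary using (¬_)

-- The finite set of propositional variables 𝒳 is Fin k.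
-- A trace is an infinite sequence of subsets of 𝒳.
Trace : ℕ → Set
Trace k = ℕ → Subset k

TraceSet : ℕ → Set₁
TraceSet k = Pred (Trace k) 0ℓ

-- Trace variables and time variables are both named by natural numbers;
-- they live in disjoint namespaces (separate assignments).
TraceVar : Set
TraceVar = ℕ

TimeVar : Set
TimeVar = ℕ

data Formula (k : ℕ) : Set where
  ∃π   : TraceVar → Formula k → Formula k
  ∃ᵀπ  : TraceVar → Formula k → Formula k
  ∃i   : TimeVar → Formula k → Formula k
  ¬f   : Formula k → Formula k
  _∨f_ : Formula k → Formula k → Formula k
  _<f_ : TimeVar → TimeVar → Formula k
  _=f_ : TimeVar → TimeVar → Formula k
  atom : Fin k → TraceVar → TimeVar → Formula k

∀π : ∀ {k} → TraceVar → Formula k → Formula k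
∀π x φ = ¬f (∃π x (¬f φ))

∀ᵀπ : ∀ {k} → TraceVar → Formula k → Formula k
∀ᵀπ x φ = ¬f (∃ᵀπ x (¬f φ))

∀i : ∀ {k} → TimeVar → Formula k → Formula k
∀i x φ = ¬f (∃i x (¬f φ))

upd : ∀ {A : Set} → (ℕ → A) → ℕ → A → (ℕ → A)
upd f x v y = if y ≡ᵇ x then v else f y

Sat : ∀ {k} → TraceSet k → (TraceVar → Trace k) → (TimeVar → ℕ) → Formula k → Set
Sat T Π I (∃π x φ)  = Σ (Trace _) (λ t → Sat T (upd Π x t) I φ)
Sat T Π I (∃ᵀπ x φ) = Σ (Trace _) (λ t → T t × Sat T (upd Π x t) I φ)
Sat T Π I (∃i j φ)  = Σ ℕ (λ n → Sat T Π (upd I j n) φ)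
Sat T Π I (¬f φ)    = ¬ Sat T Π I φ
Sat T Π I (φ ∨f ψ)  = Sat T Π I φ ⊎ Sat T Π I ψ
Sat T Π I (i <f j)  = I i <ℕ I j
Sat T Π I (i =f j)  = I i ≡ I j
Sat T Π I (atom x π i) = x ∈ Π π (I i)

_⊨_ : ∀ {k} → TraceSet k → Formula k → Set
T ⊨ φ = Σ (TraceVar → Trace _) (λ Π → Σ (TimeVar → ℕ) (λ I → Sat T Π I φ))

LangNonEmpty : ∀ {k} → Formula k → Set₁
LangNonEmpty {k} φ = Σ (TraceSet k) (λ T → T ⊨ φ)

data Unconstrained {k} : Formula k → Set where
  u-∃π  : ∀ {x φ} → Unconstrained φ → Unconstrained (∃π x φ)
  u-∃i  : ∀ {x φ} → Unconstrained φ → Unconstrained (∃i x φ)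
  u-¬   : ∀ {φ} → Unconstrained φ → Unconstrained (¬f φ)
  u-∨   : ∀ {φ ψ} → Unconstrained φ → Unconstrained ψ → Unconstrained (φ ∨f ψ)
  u-<   : ∀ {i j} → Unconstrained (i <f j)
  u-=   : ∀ {i j} → Unconstrained (i =f j)
  u-atom : ∀ {x π i} → Unconstrained (atom {k} x π i)

data QuantFree {k} : Formula k → Set where
  qf-¬   : ∀ {φ} → QuantFree φ → QuantFree (¬f φ)
  qf-∨   : ∀ {φ ψ} → QuantFree φ → QuantFree ψ → QuantFree (φ ∨f ψ)
  qf-<   : ∀ {i j} → QuantFree (i <f j)
  qf-=   : ∀ {i j} → QuantFree (i =f j)
  qf-atom : ∀ {x π i} → QuantFree (atom {k} x π i)

data Quant : Set where
  ∃time ∀time : TimeVar → Quant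
  ∃trace ∀trace : TraceVar → Quant
  ∃ᵀtrace ∀ᵀtrace : TraceVar → Quant

applyQ : ∀ {k} → Quant → Formula k → Formula k
applyQ (∃time i) φ = ∃i i φ
applyQ (∀time i) φ = ∀i i φ
applyQ (∃trace x) φ = ∃π x φ
applyQ (∀trace x) φ = ∀π x φ
applyQ (∃ᵀtrace x) φ = ∃ᵀπ x φ
applyQ (∀ᵀtrace x) φ = ∀ᵀπ x φ

prenex : ∀ {k} → List Quant → Formula k → Formula k
prenex [] φ = φ
prenex (q ∷ qs) φ = applyQ q (prenex qs φ)

data ExistentialUnconstrained : Quant → Set where
  eu-time  : ∀ {i} → ExistentialUnconstrained (∃time i)
  eu-trace : ∀ {x} → ExistentialUnconstrained (∃trace x)

data TimeOrUnconstrained : Quant → Set where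
  tu-∃time  : ∀ {i} → TimeOrUnconstrained (∃time i)
  tu-∀time  : ∀ {i} → TimeOrUnconstrained (∀time i)
  tu-∃trace : ∀ {x} → TimeOrUnconstrained (∃trace x)
  tu-∀trace : ∀ {x} → TimeOrUnconstrained (∀trace x)

{-# OPTIONS --safe #-}
-- A constrained universal ∀ᵀπ′ only ranges over the model T, and the unconstrained matrix
-- ignores T.  Hence if T is a model with witnesses w₁ … wₙ for ∃ᵀπ₁ … ∃ᵀπₙ, so is the finite
-- set of the values the πᵢ finally hold: the existentials keep their witnesses and the
-- universals only lose instances.  The unconstrained formula guesses these values with ∃π,
-- stores copies of them in fresh trace variables (which no later quantifier rebinds), and
-- relativises every ∀ᵀπ′ to ∀π′ (π′ equals one of the copies → …).  Without constrained
-- universals the constrained existentials can simply be made unconstrained, taking T to be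
-- the set of all traces.
module Submission where

open import Defs
open import Data.Nat using (ℕ; zero; suc; _+_; _<_; _≡ᵇ_; z≤n; s≤s)
open import Data.Nat.Properties using (≡ᵇ⇒≡; ≡⇒≡ᵇ; <⇒≢; <-≤-trans; m≤n+m; +-suc; n<1+n; m<n⇒m<1+n)
open import Data.Bool using (true; false)
open import Data.Bool.Base using () renaming (T to True)
open import Data.List using (List; []; _∷_; _++_; map; length; allFin)
open import Data.List.Extrema.Nat using (max; xs≤max)
open import Data.List.Relation.Unary.All as All using (All; []; _∷_)
open import Data.List.Relation.Unary.All.Properties using (++⁻) renaming (map⁺ to All-map⁺; map⁻ to All-map⁻)
open import Data.List.Relation.Unary.Any as Any using (Any; here; there)
open import Data.List.Relation.Unary.Any.Properties using () renaming (map⁺ to Any-map⁺; map⁻ to Any-map⁻)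
open import Data.List.Membership.Propositional using (_∈_; _∉_; find; lose)
open import Data.List.Membership.Propositional.Properties using (∈-allFin; ∈-map⁺; ∈-map⁻; ∈-++⁺ˡ; ∈-++⁺ʳ)
open import Data.Fin using (Fin)
open import Data.Fin.Subset using () renaming (_∈_ to _∈ˢ_)
open import Data.Fin.Subset.Properties using (⊆-antisym) renaming (_∈?_ to _∈ˢ?_)
open import Data.Product using (Σ; _×_; _,_)
open import Data.Sum using (_⊎_; inj₁; inj₂)
open import Data.Unit using (⊤; tt)
open import Data.Empty using (⊥-elim)
open import Function using (_∘_)
open import Function.Bundles using (_⇔_; mk⇔)
open import Relation.Nullary using (¬_; yes; no)
open import Relation.Nullary.Negation using (Stable; negated-stable)
open import Relation.Binary.PropositionalEquality

upd-elim : ∀ {A : Set} (P : A → Set) (f : ℕ → A) x v y →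
           (y ≡ x → P v) → (y ≢ x → P (f y)) → P (upd f x v y)
upd-elim P f x v y same other with y ≡ᵇ x in eq
... | true  = same (≡ᵇ⇒≡ y x (subst True (sym eq) tt))
... | false = other (λ y≡x → subst True eq (≡⇒≡ᵇ y x y≡x))

upd-same : ∀ {A : Set} (f : ℕ → A) x v → upd f x v x ≡ v
upd-same f x v = upd-elim (_≡ v) f x v x (λ _ → refl) (λ x≢x → ⊥-elim (x≢x refl))

upd-other : ∀ {A : Set} (f : ℕ → A) x v {y} → y ≢ x → upd f x v y ≡ f y
upd-other f x v {y} y≢x = upd-elim (_≡ f y) f x v y (λ y≡x → ⊥-elim (y≢x y≡x)) (λ _ → refl)

prenex-++ : ∀ {k} A B {φ : Formula k} → prenex (A ++ B) φ ≡ prenex A (prenex B φ)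
prenex-++ []      B = refl
prenex-++ (q ∷ A) B = cong (applyQ q) (prenex-++ A B)

ExistentialUnconstrained⇒TimeOrUnconstrained : ∀ {q} → ExistentialUnconstrained q → TimeOrUnconstrained q
ExistentialUnconstrained⇒TimeOrUnconstrained eu-time  = tu-∃time
ExistentialUnconstrained⇒TimeOrUnconstrained eu-trace = tu-∃trace

consecutive : ℕ → ℕ → List ℕ
consecutive f zero    = []
consecutive f (suc n) = f ∷ consecutive (suc f) n

consecutive-∉ : ∀ {x f} n → x < f → x ∉ consecutive f n
consecutive-∉ (suc n) x<f (here refl) = <⇒≢ x<f refl
consecutive-∉ (suc n) x<f (there x∈) = consecutive-∉ n (m<n⇒m<1+n x<f) x∈

All<suc-max : ∀ xs → All (_< suc (max 0 xs)) xs
All<suc-max xs = All.map s≤s (xs≤max 0 xs)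

module _ {k : ℕ} where

  Assignment : Set
  Assignment = TraceVar → Trace k

  Agree : (TraceVar → Set) → Assignment → Assignment → Set
  Agree P Π Π′ = ∀ x → P x → Π x ≗ Π′ x

  Agree-sym : ∀ {P Π Π′} → Agree P Π Π′ → Agree P Π′ Π
  Agree-sym a x Px i = sym (a x Px i)

  Agree-upd : ∀ {P Π Π′} x {t t′} → t ≗ t′ → Agree P Π Π′ → Agree P (upd Π x t) (upd Π′ x t′)
  Agree-upd x t≗t′ a y Py i with y ≡ᵇ x
  ... | true  = t≗t′ i
  ... | false = a y Py i

  traceAtoms : Formula k → List TraceVar
  traceAtoms (∃π _ φ)     = traceAtoms φ
  traceAtoms (∃ᵀπ _ φ)    = traceAtoms φ
  traceAtoms (∃i _ φ)     = traceAtoms φ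
  traceAtoms (¬f φ)       = traceAtoms φ
  traceAtoms (φ ∨f ψ)     = traceAtoms φ ++ traceAtoms ψ
  traceAtoms (_ <f _)     = []
  traceAtoms (_ =f _)     = []
  traceAtoms (atom _ π _) = π ∷ []

  Sat-local : ∀ φ {T Π Π′ I} → Agree (_∈ traceAtoms φ) Π Π′ → Sat T Π I φ → Sat T Π′ I φ
  Sat-local (∃π x φ)  a (t , s)      = t , Sat-local φ (Agree-upd x (λ _ → refl) a) s
  Sat-local (∃ᵀπ x φ) a (t , Tt , s) = t , Tt , Sat-local φ (Agree-upd x (λ _ → refl) a) s
  Sat-local (∃i j φ)  a (n , s)      = n , Sat-local φ a s
  Sat-local (¬f φ)    a ¬s s′        = ¬s (Sat-local φ (Agree-sym a) s′)
  Sat-local (φ ∨f ψ)  a (inj₁ s)     = inj₁ (Sat-local φ (λ x x∈ → a x (∈-++⁺ˡ x∈)) s)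
  Sat-local (φ ∨f ψ)  a (inj₂ s)     = inj₂ (Sat-local ψ (λ x x∈ → a x (∈-++⁺ʳ (traceAtoms φ) x∈)) s)
  Sat-local (i <f j)  a s            = s
  Sat-local (i =f j)  a s            = s
  Sat-local (atom x π i) {I = I} a s = subst (x ∈ˢ_) (a π (here refl) (I i)) s

  Sat-model-irrelevant : ∀ {φ : Formula k} → Unconstrained φ → ∀ {T T′ Π I} → Sat T Π I φ → Sat T′ Π I φ
  Sat-model-irrelevant (u-∃π u)  (t , s)  = t , Sat-model-irrelevant u s
  Sat-model-irrelevant (u-∃i u)  (n , s)  = n , Sat-model-irrelevant u s
  Sat-model-irrelevant (u-¬ u)   ¬s s′    = ¬s (Sat-model-irrelevant u s′)
  Sat-model-irrelevant (u-∨ u v) (inj₁ s) = inj₁ (Sat-model-irrelevant u s)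
  Sat-model-irrelevant (u-∨ u v) (inj₂ s) = inj₂ (Sat-model-irrelevant v s)
  Sat-model-irrelevant u-<       s        = s
  Sat-model-irrelevant u-=       s        = s
  Sat-model-irrelevant u-atom    s        = s

  QuantFree⇒Unconstrained : ∀ {φ : Formula k} → QuantFree φ → Unconstrained φ
  QuantFree⇒Unconstrained (qf-¬ q)   = u-¬ (QuantFree⇒Unconstrained q)
  QuantFree⇒Unconstrained (qf-∨ q r) = u-∨ (QuantFree⇒Unconstrained q) (QuantFree⇒Unconstrained r)
  QuantFree⇒Unconstrained qf-<       = u-<
  QuantFree⇒Unconstrained qf-=       = u-=
  QuantFree⇒Unconstrained qf-atom    = u-atom

  Unconstrained-prenex : ∀ {Q} {φ : Formula k} → All TimeOrUnconstrained Q → Unconstrained φ → Unconstrained (prenex Q φ)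
  Unconstrained-prenex []                 u = u
  Unconstrained-prenex (tu-∃time  ∷ Q-ok) u = u-∃i (Unconstrained-prenex Q-ok u)
  Unconstrained-prenex (tu-∀time  ∷ Q-ok) u = u-¬ (u-∃i (u-¬ (Unconstrained-prenex Q-ok u)))
  Unconstrained-prenex (tu-∃trace ∷ Q-ok) u = u-∃π (Unconstrained-prenex Q-ok u)
  Unconstrained-prenex (tu-∀trace ∷ Q-ok) u = u-¬ (u-∃π (u-¬ (Unconstrained-prenex Q-ok u)))

  ⊥f : Formula k
  ⊥f = ¬f (0 =f 0)

  _⇒f_ : Formula k → Formula k → Formula k
  φ ⇒f ψ = ¬f φ ∨f ψ

  ⋁ : List (Formula k) → Formula k
  ⋁ []       = ⊥f
  ⋁ (φ ∷ φs) = φ ∨f ⋁ φs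

  ⋀ : List (Formula k) → Formula k
  ⋀ φs = ¬f (⋁ (map ¬f φs))

  Sat-⋁⁺ : ∀ {T Π I φs} → Any (Sat T Π I) φs → Sat T Π I (⋁ φs)
  Sat-⋁⁺ (here s)  = inj₁ s
  Sat-⋁⁺ (there s) = inj₂ (Sat-⋁⁺ s)

  Sat-⋁⁻ : ∀ {T Π I} φs → Sat T Π I (⋁ φs) → Any (Sat T Π I) φs
  Sat-⋁⁻ []       s        = ⊥-elim (s refl)
  Sat-⋁⁻ (φ ∷ φs) (inj₁ s) = here s
  Sat-⋁⁻ (φ ∷ φs) (inj₂ s) = there (Sat-⋁⁻ φs s)

  Sat-⋀⁺ : ∀ {T Π I φs} → All (Sat T Π I) φs → Sat T Π I (⋀ φs)
  Sat-⋀⁺ []       ⊥s        = ⊥s refl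
  Sat-⋀⁺ (s ∷ ss) (inj₁ ¬s) = ¬s s
  Sat-⋀⁺ (s ∷ ss) (inj₂ r)  = Sat-⋀⁺ ss r

  Sat-⋀⁻ : ∀ {T Π I φs} → All (Stable ∘ Sat T Π I) φs → Sat T Π I (⋀ φs) → All (Sat T Π I) φs
  Sat-⋀⁻ []           s = []
  Sat-⋀⁻ (st ∷ stable) s = st (s ∘ inj₁) ∷ Sat-⋀⁻ stable (s ∘ inj₂)

  differAt : TraceVar → TraceVar → Fin k → Formula k
  differAt π π′ x = ¬f (atom x π 0 ⇒f atom x π′ 0) ∨f ¬f (atom x π′ 0 ⇒f atom x π 0)

  _≐_ : TraceVar → TraceVar → Formula k
  π ≐ π′ = ¬f (∃i 0 (⋁ (map (differAt π π′) (allFin k))))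

  Sat-≐⁺ : ∀ {T Π I π π′} → Π π ≗ Π π′ → Sat T Π I (π ≐ π′)
  Sat-≐⁺ e (n , d) with find (Any-map⁻ (Sat-⋁⁻ _ d))
  ... | x , _ , inj₁ ¬π⊆π′ = ¬π⊆π′ (inj₁ (λ x∈π → ¬π⊆π′ (inj₂ (subst (x ∈ˢ_) (e n) x∈π))))
  ... | x , _ , inj₂ ¬π′⊆π = ¬π′⊆π (inj₁ (λ x∈π′ → ¬π′⊆π (inj₂ (subst (x ∈ˢ_) (sym (e n)) x∈π′))))

  Sat-≐⁻ : ∀ {T Π I π π′} → Sat T Π I (π ≐ π′) → Π π ≗ Π π′
  Sat-≐⁻ {T} {Π} {I} {π} {π′} s i = ⊆-antisym (λ {x} → included x) (λ {x} → included′ x)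
    where
    no-difference : ∀ x → ¬ Sat T Π (upd I 0 i) (differAt π π′ x)
    no-difference x d = s (i , Sat-⋁⁺ (Any-map⁺ (lose (∈-allFin x) d)))
    included : ∀ x → x ∈ˢ Π π i → x ∈ˢ Π π′ i
    included x x∈π with x ∈ˢ? Π π′ i
    ... | yes x∈π′ = x∈π′
    ... | no  x∉π′ = ⊥-elim (no-difference x (inj₁ λ { (inj₁ x∉π) → x∉π x∈π ; (inj₂ x∈π′) → x∉π′ x∈π′ }))
    included′ : ∀ x → x ∈ˢ Π π′ i → x ∈ˢ Π π i
    included′ x x∈π′ with x ∈ˢ? Π π i
    ... | yes x∈π = x∈π
    ... | no  x∉π = ⊥-elim (no-difference x (inj₂ λ { (inj₁ x∉π′) → x∉π′ x∈π′ ; (inj₂ x∈π) → x∉π x∈π }))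

  Unconstrained-⋁ : ∀ {φs} → All Unconstrained φs → Unconstrained (⋁ φs)
  Unconstrained-⋁ []       = u-¬ u-=
  Unconstrained-⋁ (u ∷ us) = u-∨ u (Unconstrained-⋁ us)

  Unconstrained-⋀ : ∀ {φs} → All Unconstrained φs → Unconstrained (⋀ φs)
  Unconstrained-⋀ us = u-¬ (Unconstrained-⋁ (All-map⁺ (All.map u-¬ us)))

  Unconstrained-≐ : ∀ {π π′} → Unconstrained (π ≐ π′)
  Unconstrained-≐ {π} {π′} = u-¬ (u-∃i (Unconstrained-⋁ (All-map⁺ (All.universal differAt-ok (allFin k)))))
    where
    differAt-ok : ∀ x → Unconstrained (differAt π π′ x)
    differAt-ok x = u-∨ (u-¬ (u-∨ (u-¬ u-atom) u-atom)) (u-¬ (u-∨ (u-¬ u-atom) u-atom))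

  ∃π* ∃ᵀπ* ∀ᵀπ* : List TraceVar → Formula k → Formula k
  ∃π*  xs = prenex (map ∃trace xs)
  ∃ᵀπ* xs = prenex (map ∃ᵀtrace xs)
  ∀ᵀπ* xs = prenex (map ∀ᵀtrace xs)

  Unconstrained-∃π* : ∀ xs {φ} → Unconstrained φ → Unconstrained (∃π* xs φ)
  Unconstrained-∃π* xs = Unconstrained-prenex (All-map⁺ (All.universal (λ _ → tu-∃trace) xs))

  updAll : Assignment → List TraceVar → (ℕ → Trace k) → Assignment
  updAll Π []       ws = Π
  updAll Π (x ∷ xs) ws = updAll (upd Π x (ws 0)) xs (ws ∘ suc)

  updAll-∉ : ∀ Π xs ws {x} → x ∉ xs → updAll Π xs ws x ≡ Π x
  updAll-∉ Π []       ws x∉ = refl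
  updAll-∉ Π (y ∷ xs) ws x∉ = trans (updAll-∉ _ xs _ (x∉ ∘ there)) (upd-other Π y (ws 0) (x∉ ∘ here))

  updAll-preserves : ∀ (P : Trace k → Set) Π xs ws {x} → (∀ j → j < length xs → P (ws j)) →
                     x ∈ xs ⊎ P (Π x) → P (updAll Π xs ws x)
  updAll-preserves P Π []       ws Pws (inj₂ PΠx) = PΠx
  updAll-preserves P Π (y ∷ xs) ws {x} Pws x∈⊎PΠx =
    updAll-preserves P (upd Π y (ws 0)) xs (ws ∘ suc) (λ j j<n → Pws (suc j) (s≤s j<n)) (step x∈⊎PΠx)
    where
    Pw₀ = Pws 0 (s≤s z≤n)
    step : x ∈ y ∷ xs ⊎ P (Π x) → x ∈ xs ⊎ P (upd Π y (ws 0) x)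
    step (inj₁ (here x≡y)) = inj₂ (upd-elim P Π y (ws 0) x (λ _ → Pw₀) (λ x≢y → ⊥-elim (x≢y x≡y)))
    step (inj₁ (there x∈)) = inj₁ x∈
    step (inj₂ PΠx)        = inj₂ (upd-elim P Π y (ws 0) x (λ _ → Pw₀) (λ _ → PΠx))

  updAll-consecutive : ∀ Π f n ws j → j < n → updAll Π (consecutive f n) ws (j + f) ≡ ws j
  updAll-consecutive Π f (suc n) ws zero    _ =
    trans (updAll-∉ _ (consecutive (suc f) n) _ (consecutive-∉ n (n<1+n f))) (upd-same Π f (ws 0))
  updAll-consecutive Π f (suc n) ws (suc j) (s≤s j<n) =
    trans (cong (updAll _ (consecutive (suc f) n) _) (sym (+-suc j f)))
          (updAll-consecutive _ (suc f) n (ws ∘ suc) j j<n)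

  ∃π*-elim : ∀ xs {T Π I X} → Sat T Π I (∃π* xs X) → Σ (ℕ → Trace k) λ ws → Sat T (updAll Π xs ws) I X
  ∃π*-elim []       {Π = Π} s = (λ _ → Π 0) , s
  ∃π*-elim (x ∷ xs) (t , s) with ∃π*-elim xs s
  ... | ws , s′ = (λ { zero → t ; (suc j) → ws j }) , s′

  ∃π*-intro : ∀ xs ws {T Π I X} → Sat T (updAll Π xs ws) I X → Sat T Π I (∃π* xs X)
  ∃π*-intro []       ws s = s
  ∃π*-intro (x ∷ xs) ws s = ws 0 , ∃π*-intro xs (ws ∘ suc) s

  ∃ᵀπ*-elim : ∀ xs {T Π I X} → Sat T Π I (∃ᵀπ* xs X) →
              Σ (ℕ → Trace k) λ ws → (∀ j → j < length xs → T (ws j)) × Sat T (updAll Π xs ws) I X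
  ∃ᵀπ*-elim []       {Π = Π} s = (λ _ → Π 0) , (λ _ ()) , s
  ∃ᵀπ*-elim (x ∷ xs) (t , Tt , s) with ∃ᵀπ*-elim xs s
  ... | ws , Tws , s′ = (λ { zero → t ; (suc j) → ws j }) , (λ { zero _ → Tt ; (suc j) (s≤s j<n) → Tws j j<n }) , s′

  -- Each xᵢ is bound to the value it has in Π′ at the end, which is a legal witness even
  -- when xᵢ is rebound later on.
  ∃ᵀπ*-intro : ∀ xs {T Π Π′ I X} → (∀ x → x ∉ xs → Π x ≡ Π′ x) → (∀ x → x ∈ xs → T (Π′ x)) →
               Sat T Π′ I X → Sat T Π I (∃ᵀπ* xs X)
  ∃ᵀπ*-intro []       {X = X} Π≡Π′ _ s = Sat-local X (λ x _ → cong-app (sym (Π≡Π′ x λ ()))) s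
  ∃ᵀπ*-intro (x ∷ xs) {Π = Π} {Π′} Π≡Π′ T∋Π′ s =
    Π′ x , T∋Π′ x (here refl) , ∃ᵀπ*-intro xs agree (λ y y∈ → T∋Π′ y (there y∈)) s
    where
    agree : ∀ y → y ∉ xs → upd Π x (Π′ x) y ≡ Π′ y
    agree y y∉ = upd-elim (_≡ Π′ y) Π x (Π′ x) y (λ y≡x → cong Π′ (sym y≡x))
                   (λ y≢x → Π≡Π′ y λ { (here y≡x) → y≢x y≡x ; (there y∈) → y∉ y∈ })

  _⇛_ : Formula k → Formula k → Set₁
  φ ⇛ ψ = ∀ {T Π I} → Sat T Π I φ → Σ (TraceSet k) λ T′ → Sat T′ Π I ψ

  prenex-⇛ : ∀ {E φ ψ} → All ExistentialUnconstrained E → φ ⇛ ψ → prenex E φ ⇛ prenex E ψ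
  prenex-⇛ []              φ⇛ψ s       = φ⇛ψ s
  prenex-⇛ (eu-time  ∷ E-ok) φ⇛ψ (n , s) = let T′ , s′ = prenex-⇛ E-ok φ⇛ψ s in T′ , n , s′
  prenex-⇛ (eu-trace ∷ E-ok) φ⇛ψ (t , s) = let T′ , s′ = prenex-⇛ E-ok φ⇛ψ s in T′ , t , s′

  ⇛-LangNonEmpty : ∀ {φ ψ} → φ ⇛ ψ → LangNonEmpty φ → LangNonEmpty ψ
  ⇛-LangNonEmpty φ⇛ψ (T , Π , I , s) = let T′ , s′ = φ⇛ψ s in T′ , Π , I , s′

  -- N must exceed every trace variable of the matrix, of ps and of the universals, so that
  -- the copies p + N are fresh.
  module Relativisation (N : ℕ) (ps : List TraceVar) where

    copy : TraceVar → TraceVar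
    copy p = p + N

    copyBlock : List TraceVar
    copyBlock = consecutive N N

    InCopies : TraceVar → Formula k
    InCopies q = ⋁ (map (λ p → q ≐ copy p) ps)

    ∀ᶜπ* : List TraceVar → Formula k → Formula k
    ∀ᶜπ* []       ψ = ψ
    ∀ᶜπ* (q ∷ qs) ψ = ∀π q (InCopies q ⇒f ∀ᶜπ* qs ψ)

    Matrix : List TraceVar → Formula k → Formula k
    Matrix qs ψ = ⋀ (∀ᶜπ* qs ψ ∷ map (λ p → copy p ≐ p) ps)

    Relativised : List TraceVar → Formula k → Formula k
    Relativised qs ψ = ∃π* ps (∃π* copyBlock (Matrix qs ψ))

    Unconstrained-InCopies : ∀ q → Unconstrained (InCopies q)
    Unconstrained-InCopies q = Unconstrained-⋁ (All-map⁺ (All.universal (λ _ → Unconstrained-≐) ps))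

    Unconstrained-∀ᶜπ* : ∀ qs {ψ} → Unconstrained ψ → Unconstrained (∀ᶜπ* qs ψ)
    Unconstrained-∀ᶜπ* []       u = u
    Unconstrained-∀ᶜπ* (q ∷ qs) u = u-¬ (u-∃π (u-¬ (u-∨ (u-¬ (Unconstrained-InCopies q)) (Unconstrained-∀ᶜπ* qs u))))

    Unconstrained-Relativised : ∀ qs {ψ} → Unconstrained ψ → Unconstrained (Relativised qs ψ)
    Unconstrained-Relativised qs u =
      Unconstrained-∃π* ps (Unconstrained-∃π* copyBlock
        (Unconstrained-⋀ (Unconstrained-∀ᶜπ* qs u ∷ All-map⁺ (All.universal (λ _ → Unconstrained-≐) ps))))

    upd-copy : ∀ {A : Set} (f : ℕ → A) {q} t p → q < N → upd f q t (copy p) ≡ f (copy p)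
    upd-copy f t p q<N = upd-other f _ t (λ e → <⇒≢ (<-≤-trans q<N (m≤n+m N p)) (sym e))

    Sat-InCopies-upd⁺ : ∀ {T Π I q t} → q < N → Any (λ p → t ≗ Π (copy p)) ps → Sat T (upd Π q t) I (InCopies q)
    Sat-InCopies-upd⁺ {Π = Π} {q = q} {t} q<N =
      Sat-⋁⁺ ∘ Any-map⁺ ∘ Any.map (λ {p} → Sat-≐⁺ ∘ subst₂ _≗_ (sym (upd-same Π q t)) (sym (upd-copy Π t p q<N)))

    Sat-InCopies-upd⁻ : ∀ {T Π I q t} → q < N → Sat T (upd Π q t) I (InCopies q) → Any (λ p → t ≗ Π (copy p)) ps
    Sat-InCopies-upd⁻ {Π = Π} {q = q} {t} q<N =
      Any.map (λ {p} → subst₂ _≗_ (upd-same Π q t) (upd-copy Π t p q<N) ∘ Sat-≐⁻) ∘ Any-map⁻ ∘ Sat-⋁⁻ _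

    CopiesIn : TraceSet k → Assignment → Set
    CopiesIn T Π = ∀ p → p ∈ ps → T (Π (copy p))

    CopiesCover : TraceSet k → Assignment → Set
    CopiesCover T Π = ∀ t → T t → Any (λ p → t ≗ Π (copy p)) ps

    CopiesIn-upd : ∀ {T Π q t} → q < N → CopiesIn T Π → CopiesIn T (upd Π q t)
    CopiesIn-upd {T} {Π} {t = t} q<N T∋copies p p∈ = subst T (sym (upd-copy Π t p q<N)) (T∋copies p p∈)

    CopiesCover-upd : ∀ {T Π q t} → q < N → CopiesCover T Π → CopiesCover T (upd Π q t)
    CopiesCover-upd {Π = Π} {t = t} q<N cover t′ Tt′ =
      Any.map (λ {p} → subst (t′ ≗_) (sym (upd-copy Π t p q<N))) (cover t′ Tt′)

    module _ {ψ} (ψ-ok : Unconstrained ψ) (ψ<N : All (_< N) (traceAtoms ψ)) where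

      ∀ᵀ⇒∀ᶜ : ∀ qs → All (_< N) qs → ∀ {T T′ Πₒ Πₙ I} → Agree (_< N) Πₒ Πₙ → CopiesIn T Πₙ →
              Sat T Πₒ I (∀ᵀπ* qs ψ) → Sat T′ Πₙ I (∀ᶜπ* qs ψ)
      ∀ᵀ⇒∀ᶜ [] _ a _ s = Sat-model-irrelevant ψ-ok (Sat-local ψ (λ x x∈ → a x (All.lookup ψ<N x∈)) s)
      ∀ᵀ⇒∀ᶜ (q ∷ qs) (q<N ∷ qs<N) {T} {T′} {Πₙ = Πₙ} {I} a T∋copies s (t , ¬r) = ¬r (inj₁ not-a-copy)
        where
        not-a-copy : ¬ Sat T′ (upd Πₙ q t) I (InCopies q)
        not-a-copy inC with find (Sat-InCopies-upd⁻ {Π = Πₙ} q<N inC)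
        ... | p , p∈ , t≗ =
          s (Πₙ (copy p) , T∋copies p p∈ ,
             ¬r ∘ inj₂ ∘ ∀ᵀ⇒∀ᶜ qs qs<N (Agree-upd q (sym ∘ t≗) a) (CopiesIn-upd {T} {Πₙ} q<N T∋copies))

      ∀ᶜ⇒∀ᵀ : ∀ qs → All (_< N) qs → ∀ {T T′ Πₒ Πₙ I} → Agree (_< N) Πₒ Πₙ → CopiesCover T Πₙ →
              Sat T′ Πₙ I (∀ᶜπ* qs ψ) → Sat T Πₒ I (∀ᵀπ* qs ψ)
      ∀ᶜ⇒∀ᵀ [] _ a _ s = Sat-model-irrelevant ψ-ok (Sat-local ψ (λ x x∈ → Agree-sym a x (All.lookup ψ<N x∈)) s)
      ∀ᶜ⇒∀ᵀ (q ∷ qs) (q<N ∷ qs<N) {T} {Πₙ = Πₙ} a cover s (t , Tt , ¬r) =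
        s (t , λ { (inj₁ ¬inC) → ¬inC (Sat-InCopies-upd⁺ q<N (cover t Tt))
                 ; (inj₂ r)    → ¬r (∀ᶜ⇒∀ᵀ qs qs<N (Agree-upd q (λ _ → refl) a) (CopiesCover-upd {T} {Πₙ} q<N cover) r) })

      ∃ᵀ∀ᵀ⇒Relativised : ∀ qs → All (_< N) ps → All (_< N) qs → ∀ {T Π I} →
                         Sat T Π I (∃ᵀπ* ps (∀ᵀπ* qs ψ)) → Sat T Π I (Relativised qs ψ)
      ∃ᵀ∀ᵀ⇒Relativised qs ps<N qs<N {T} {Π} {I} s with ∃ᵀπ*-elim ps s
      ... | ws , Tws , s₁ =
        ∃π*-intro ps ws (∃π*-intro copyBlock Π₁
          (Sat-⋀⁺ (∀ᵀ⇒∀ᶜ qs qs<N agree T∋copies s₁ ∷ All-map⁺ (All.map faithful ps<N))))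
        where
        Π₁ = updAll Π ps ws
        Π₂ = updAll Π₁ copyBlock Π₁
        below : ∀ {x} → x < N → Π₂ x ≡ Π₁ x
        below x<N = updAll-∉ Π₁ copyBlock Π₁ (consecutive-∉ N x<N)
        copied : ∀ {x} → x < N → Π₂ (copy x) ≡ Π₁ x
        copied {x} x<N = updAll-consecutive Π₁ N N Π₁ x x<N
        agree : Agree (_< N) Π₁ Π₂
        agree x x<N = cong-app (sym (below x<N))
        T∋copies : CopiesIn T Π₂
        T∋copies p p∈ = subst T (sym (copied (All.lookup ps<N p∈))) (updAll-preserves T Π ps ws Tws (inj₁ p∈))
        faithful : ∀ {p} → p < N → Sat T Π₂ I (copy p ≐ p)
        faithful p<N = Sat-≐⁺ (cong-app (trans (copied p<N) (sym (below p<N))))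

      -- Only negated conjuncts can be recovered from ⋀ constructively: ∀ᶜπ* (q ∷ qs) ψ is
      -- one, whereas ∀ᶜπ* [] ψ = ψ need not be.
      Relativised⇒∃ᵀ∀ᵀ : ∀ q qs → All (_< N) ps → All (_< N) (q ∷ qs) → ∀ {T₀ Π I} →
                         Sat T₀ Π I (Relativised (q ∷ qs) ψ) →
                         Σ (TraceSet k) λ T → Sat T Π I (∃ᵀπ* ps (∀ᵀπ* (q ∷ qs) ψ))
      Relativised⇒∃ᵀ∀ᵀ q qs ps<N qs<N {Π = Π} s
        with ∃π*-elim ps {X = ∃π* copyBlock (Matrix (q ∷ qs) ψ)} s
      ... | ws , s₁ with ∃π*-elim copyBlock {X = Matrix (q ∷ qs) ψ} s₁
      ... | vs , s₂
        with Sat-⋀⁻ {φs = ∀ᶜπ* (q ∷ qs) ψ ∷ map (λ p → copy p ≐ p) ps}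
                    (negated-stable ∷ All-map⁺ (All.universal (λ _ → negated-stable) ps)) s₂
      ... | relativised ∷ faithful =
        (_∈ map Π₁ ps) ,
        ∃ᵀπ*-intro ps (λ x x∉ → sym (updAll-∉ Π ps ws x∉)) (λ x x∈ → ∈-map⁺ Π₁ x∈)
          (∀ᶜ⇒∀ᵀ (q ∷ qs) qs<N agree cover relativised)
        where
        Π₁ = updAll Π ps ws
        Π₂ = updAll Π₁ copyBlock vs
        below : ∀ {x} → x < N → Π₂ x ≡ Π₁ x
        below x<N = updAll-∉ Π₁ copyBlock vs (consecutive-∉ N x<N)
        agree : Agree (_< N) Π₁ Π₂
        agree x x<N = cong-app (sym (below x<N))
        cover : CopiesCover (_∈ map Π₁ ps) Π₂
        cover t t∈ with ∈-map⁻ Π₁ t∈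
        ... | p , p∈ , refl = lose p∈ (λ i → trans (agree p (All.lookup ps<N p∈) i)
                                                   (sym (Sat-≐⁻ (All.lookup (All-map⁻ faithful) p∈) i)))

  ∃ᵀπ*⇛∃π* : ∀ ps {ψ} → ∃ᵀπ* ps ψ ⇛ ∃π* ps ψ
  ∃ᵀπ*⇛∃π* ps {T = T} s = let ws , _ , s₁ = ∃ᵀπ*-elim ps s in T , ∃π*-intro ps ws s₁

  ∃π*⇛∃ᵀπ* : ∀ ps {ψ} → Unconstrained ψ → ∃π* ps ψ ⇛ ∃ᵀπ* ps ψ
  ∃π*⇛∃ᵀπ* ps u {Π = Π} s =
    let ws , s₁ = ∃π*-elim ps s
    in (λ _ → ⊤) , ∃ᵀπ*-intro ps (λ x x∉ → sym (updAll-∉ Π ps ws x∉)) (λ _ _ → tt) (Sat-model-irrelevant u s₁)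

  constrained-prefix-elimination : ∀ ps qs {ψ} → Unconstrained ψ →
    Σ (Formula k) λ φu → Unconstrained φu × (∃ᵀπ* ps (∀ᵀπ* qs ψ) ⇛ φu) × (φu ⇛ ∃ᵀπ* ps (∀ᵀπ* qs ψ))
  constrained-prefix-elimination ps [] u = ∃π* ps _ , Unconstrained-∃π* ps u , ∃ᵀπ*⇛∃π* ps , ∃π*⇛∃ᵀπ* ps u
  constrained-prefix-elimination ps (q ∷ qs) {ψ} u
    with ++⁻ (traceAtoms ψ) (All<suc-max (traceAtoms ψ ++ ps ++ q ∷ qs))
  ... | ψ<N , ps++qs<N with ++⁻ ps ps++qs<N
  ... | ps<N , qs<N =
    Relativised (q ∷ qs) ψ , Unconstrained-Relativised (q ∷ qs) u ,
    (λ {T} s → T , ∃ᵀ∀ᵀ⇒Relativised u ψ<N (q ∷ qs) ps<N qs<N s) , Relativised⇒∃ᵀ∀ᵀ u ψ<N q qs ps<N qs<N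
    where open Relativisation (suc (max 0 (traceAtoms ψ ++ ps ++ q ∷ qs))) ps

theorem4 : (k : ℕ) (E : List Quant) (πs π′s : List TraceVar) (Q : List Quant)
           (φqf : Formula k) →
           All ExistentialUnconstrained E → All TimeOrUnconstrained Q → QuantFree φqf →
           Σ (Formula k) (λ φu → Unconstrained φu ×
             (LangNonEmpty (prenex (E ++ map ∃ᵀtrace πs ++ map ∀ᵀtrace π′s ++ Q) φqf)
              ⇔ LangNonEmpty φu))
theorem4 k E πs π′s Q φqf E-ok Q-ok φqf-ok
  with constrained-prefix-elimination πs π′s (Unconstrained-prenex Q-ok (QuantFree⇒Unconstrained φqf-ok))
... | φc , φc-ok , to , from =
  prenex E φc ,
  Unconstrained-prenex (All.map ExistentialUnconstrained⇒TimeOrUnconstrained E-ok) φc-ok ,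
  mk⇔ (⇛-LangNonEmpty (prenex-⇛ E-ok to) ∘ subst LangNonEmpty split)
      (subst LangNonEmpty (sym split) ∘ ⇛-LangNonEmpty (prenex-⇛ E-ok from))
  where
  split : prenex (E ++ map ∃ᵀtrace πs ++ map ∀ᵀtrace π′s ++ Q) φqf ≡ prenex E (∃ᵀπ* πs (∀ᵀπ* π′s (prenex Q φqf)))
  split = trans (prenex-++ E _) (cong (prenex E) (trans (prenex-++ (map ∃ᵀtrace πs) _)
                                                        (cong (∃ᵀπ* πs) (prenex-++ (map ∀ᵀtrace π′s) Q))))
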